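{- There is an absolute constant $C>0$ such that the following holds. Let $\{N+1,\dots,N+H\}$ be a very bad interval of length $H > 1$. Then there exist natural numbers $a,b,n,m$ and an integer $h$ with $$ an + h = bm,$$ $an, bm \in \{N+1,\dots,N+H\}$, $1 \leq h \leq H$, $a,b \leq C H^{C}$, and $n,m$ powerful.
   Context: A natural number is powerful if every prime dividing it divides it at least twice. An interval $\{N+1,\dots,N+H\}$ (with $N\ge 0$, $H \ge 1$) is very bad if the product $(N+1)\cdots(N+H)$ is powerful. -}

module Defs where

open import Data.Nat using (ℕ; zero; suc; _+_; _*_; _^_)
open import Data.Nat.Divisibility using (_∣_)
open import Data.Nat.Primality using (Prime)

Powerful : ℕ → Set
Powerful n = ∀ p → Prime p → p ∣ n → p ^ 2 ∣ n

intervalProduct : ℕ → ℕ → ℕ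
intervalProduct N zero    = 1
intervalProduct N (suc H) = intervalProduct N H * (N + suc H)

VeryBad : ℕ → ℕ → Set
VeryBad N H = Powerful (intervalProduct N H)

{-# OPTIONS --safe #-}
-- Write each x in the interval as x = a(x) * n(x), where a(x) is the product of
-- the primes p ≤ H with p ∣ x and p² ∤ x. A prime p > H divides at most one
-- element of the interval, so when the interval is very bad p² divides that
-- element; hence n(x) is powerful. Moreover a(x) is at most the product rad(x)
-- of all primes p ≤ H dividing x, and ∏ rad(x) over the interval is at most
-- H^H * H^H, since each p ≤ H divides at most one more element of the interval
-- than of {1, ..., H}. As H^(2H) * H^5 < (H^5)^H, at least two elements N + i < N + j
-- have rad < H^5, and then a(N+i) n(N+i) + (j - i) = a(N+j) n(N+j).
module Submission where

open import Defs
open import Data.Nat using (ℕ; _+_; _*_; _^_; _≤_; _<_)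
open import Data.Product using (Σ; _×_; ∃-syntax)
open import Relation.Binary.PropositionalEquality using (_≡_)

open import Data.Nat using (zero; suc; _∸_; z≤n; s≤s; z<s; NonZero; >-nonZero; >-nonZero⁻¹; nonTrivial⇒n>1)
open import Data.Nat.Properties
open import Data.Nat.Divisibility
open import Data.Nat.Primality
  using (Prime; prime?; ¬prime[1]; euclidsLemma; prime⇒irreducible; prime⇒nonZero; prime⇒nonTrivial)
open import Data.Nat.Tactic.RingSolver using (solve-∀)
open import Data.Product using (_,_; proj₁; proj₂)
open import Data.Sum using (inj₁; inj₂)
open import Relation.Nullary using (¬_; Dec; yes; no; contradiction; ¬?; _×-dec_)
open import Relation.Unary using (Decidable)
open import Relation.Binary using (tri<; tri≈; tri>)
open import Relation.Binary.PropositionalEquality using (_≢_; refl; sym; trans; cong; cong₂; subst; subst₂)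

prime⇒≥1 : ∀ {p} → Prime p → 1 ≤ p
prime⇒≥1 {p} pp = <⇒≤ (nonTrivial⇒n>1 p {{prime⇒nonTrivial pp}})

prime∤1 : ∀ {p} → Prime p → ¬ p ∣ 1
prime∤1 pp p∣1 = ¬prime[1] (subst Prime (∣1⇒≡1 p∣1) pp)

p^2≡p*p : ∀ p → p ^ 2 ≡ p * p
p^2≡p*p p = cong (p *_) (*-identityʳ p)

m∣n∧p∣n⇒m*p∣n : ∀ {m n p} → Prime p → ¬ p ∣ m → m ∣ n → p ∣ n → m * p ∣ n
m∣n∧p∣n⇒m*p∣n {m} {p = p} pp p∤m (divides t refl) p∣tm with euclidsLemma t m pp p∣tm
... | inj₁ (divides s refl) = divides s (trans (*-assoc s p m) (cong (s *_) (*-comm p m)))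
... | inj₂ p∣m              = contradiction p∣m p∤m

p^k∣m*n⇒p^k∣n : ∀ {p m n} → Prime p → ¬ p ∣ m → ∀ k → p ^ k ∣ m * n → p ^ k ∣ n
p^k∣m*n⇒p^k∣n _ _ zero _ = 1∣ _
p^k∣m*n⇒p^k∣n {p} {m} pp p∤m (suc k) p^1+k∣mn with euclidsLemma m _ pp (m*n∣⇒m∣ p (p ^ k) p^1+k∣mn)
... | inj₁ p∣m              = contradiction p∣m p∤m
... | inj₂ (divides q refl) =
  subst (p * p ^ k ∣_) (*-comm p q) (*-monoʳ-∣ p (p^k∣m*n⇒p^k∣n pp p∤m k p^k∣mq))
  where
  p^k∣mq : p ^ k ∣ m * q
  p^k∣mq = *-cancelˡ-∣ p {{prime⇒nonZero pp}}
             (subst (p * p ^ k ∣_) (trans (sym (*-assoc m q p)) (*-comm (m * q) p)) p^1+k∣mn)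

m+n+[o∸n]≡m+o : ∀ m {n o} → n ≤ o → m + n + (o ∸ n) ≡ m + o
m+n+[o∸n]≡m+o m {n} {o} n≤o = trans (+-assoc m n (o ∸ n)) (cong (m +_) (m+[n∸m]≡n n≤o))

∣N+i∧∣N+j⇒≤j∸i : ∀ {d N i j} → d ∣ N + i → d ∣ N + j → i < j → d ≤ j ∸ i
∣N+i∧∣N+j⇒≤j∸i {d} {N} d∣N+i d∣N+j i<j =
  ∣⇒≤ {{>-nonZero (m<n⇒0<n∸m i<j)}}
      (∣m+n∣m⇒∣n (subst (d ∣_) (sym (m+n+[o∸n]≡m+o N (<⇒≤ i<j))) d∣N+j) d∣N+i)

∣N+i∧∣N+j⇒i≡j : ∀ {d N H i j} → H < d → i ≤ H → j ≤ H → d ∣ N + i → d ∣ N + j → i ≡ j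
∣N+i∧∣N+j⇒i≡j {i = i} {j} H<d i≤H j≤H d∣N+i d∣N+j with <-cmp i j
... | tri< i<j _ _ =
  contradiction (≤-trans (∣N+i∧∣N+j⇒≤j∸i d∣N+i d∣N+j i<j) (≤-trans (m∸n≤m j i) j≤H)) (<⇒≱ H<d)
... | tri≈ _ i≡j _ = i≡j
... | tri> _ _ j<i =
  contradiction (≤-trans (∣N+i∧∣N+j⇒≤j∸i d∣N+j d∣N+i j<i) (≤-trans (m∸n≤m i j) i≤H)) (<⇒≱ H<d)

∏ : ℕ → ℕ → (ℕ → ℕ) → ℕ
∏ N zero    f = 1
∏ N (suc H) f = ∏ N H f * f (N + suc H)

∏-cong : ∀ N M H {f g : ℕ → ℕ} → (∀ i → f (N + i) ≡ g (M + i)) → ∏ N H f ≡ ∏ M H g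
∏-cong N M zero    f≡g = refl
∏-cong N M (suc H) f≡g = cong₂ _*_ (∏-cong N M H f≡g) (f≡g (suc H))

∏-mono-≤ : ∀ N H {f g : ℕ → ℕ} → (∀ {i} → 1 ≤ i → i ≤ H → f (N + i) ≤ g (N + i)) → ∏ N H f ≤ ∏ N H g
∏-mono-≤ N zero    f≤g = ≤-refl
∏-mono-≤ N (suc H) f≤g =
  *-mono-≤ (∏-mono-≤ N H (λ 1≤i i≤H → f≤g 1≤i (m≤n⇒m≤1+n i≤H))) (f≤g (s≤s z≤n) ≤-refl)

∏-const : ∀ N H B → ∏ N H (λ _ → B) ≡ B ^ H
∏-const N zero    B = refl
∏-const N (suc H) B = trans (cong (_* B) (∏-const N H B)) (*-comm (B ^ H) B)

∏-≤-^ : ∀ N H {f : ℕ → ℕ} B → (∀ {i} → 1 ≤ i → i ≤ H → f (N + i) ≤ B) → ∏ N H f ≤ B ^ H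
∏-≤-^ N H B f≤B = subst (∏ N H _ ≤_) (∏-const N H B) (∏-mono-≤ N H f≤B)

∏-≥1 : ∀ N H {f : ℕ → ℕ} → (∀ x → 1 ≤ f x) → 1 ≤ ∏ N H f
∏-≥1 N zero    f≥1 = ≤-refl
∏-≥1 N (suc H) f≥1 = *-mono-≤ (∏-≥1 N H f≥1) (f≥1 _)

∏-≤-∏-suc : ∀ N H {f : ℕ → ℕ} → 1 ≤ f (N + suc H) → ∏ N H f ≤ ∏ N (suc H) f
∏-≤-∏-suc N H {f} f≥1 = m≤m*n (∏ N H f) (f (N + suc H)) {{>-nonZero f≥1}}

∏-distrib-* : ∀ N H (f g : ℕ → ℕ) → ∏ N H (λ x → f x * g x) ≡ ∏ N H f * ∏ N H g
∏-distrib-* N zero    f g = refl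
∏-distrib-* N (suc H) f g =
  trans (cong (_* (f x * g x)) (∏-distrib-* N H f g))
        ([m*n]*[o*p]≡[m*o]*[n*p] (∏ N H f) (∏ N H g) (f x) (g x))
  where x = N + suc H

∏-comm : ∀ N H M K (F : ℕ → ℕ → ℕ) → ∏ N H (λ x → ∏ M K (F x)) ≡ ∏ M K (λ y → ∏ N H (λ x → F x y))
∏-comm N H M zero    F = trans (∏-const N H 1) (^-zeroˡ H)
∏-comm N H M (suc K) F =
  trans (∏-distrib-* N H (λ x → ∏ M K (F x)) (λ x → F x (M + suc K)))
        (cong (_* ∏ N H (λ x → F x (M + suc K))) (∏-comm N H M K F))

∏-suc : ∀ N H (f : ℕ → ℕ) → ∏ N (suc H) f ≡ f (suc N) * ∏ (suc N) H f
∏-suc N zero    f = trans (*-identityˡ _) (trans (cong f (+-comm N 1)) (sym (*-identityʳ _)))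
∏-suc N (suc H) f = trans (cong₂ _*_ (∏-suc N H f) (cong f (+-suc N (suc H)))) (*-assoc (f (suc N)) _ _)

∣∏ : ∀ N H {f : ℕ → ℕ} {i} → 1 ≤ i → i ≤ H → f (N + i) ∣ ∏ N H f
∣∏ N zero    () z≤n
∣∏ N (suc H) 1≤i i≤1+H with m≤n⇒m<n∨m≡n i≤1+H
... | inj₁ (s≤s i≤H) = ∣m⇒∣m*n _ (∣∏ N H 1≤i i≤H)
... | inj₂ refl      = n∣m*n (∏ N H _)

prime∤∏ : ∀ N H {f : ℕ → ℕ} {p} → Prime p → (∀ {j} → 1 ≤ j → j ≤ H → ¬ p ∣ f (N + j)) → ¬ p ∣ ∏ N H f
prime∤∏ N zero        pp p∤f = prime∤1 pp
prime∤∏ N (suc H) {f} pp p∤f p∣∏ with euclidsLemma (∏ N H f) _ pp p∣∏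
... | inj₁ p∣∏H   = prime∤∏ N H pp (λ 1≤j j≤H → p∤f 1≤j (m≤n⇒m≤1+n j≤H)) p∣∏H
... | inj₂ p∣last = p∤f (s≤s z≤n) ≤-refl p∣last

p^k∣∏⇒p^k∣ : ∀ N H {f : ℕ → ℕ} {p i} k → Prime p → 1 ≤ i → i ≤ H →
             (∀ {j} → 1 ≤ j → j ≤ H → j ≢ i → ¬ p ∣ f (N + j)) → p ^ k ∣ ∏ N H f → p ^ k ∣ f (N + i)
p^k∣∏⇒p^k∣ N zero    k pp () z≤n
p^k∣∏⇒p^k∣ N (suc H) {f} {p} k pp 1≤i i≤1+H p∤others p^k∣∏ with m≤n⇒m<n∨m≡n i≤1+H
... | inj₁ (s≤s i≤H) =
  p^k∣∏⇒p^k∣ N H {f} k pp 1≤i i≤H (λ 1≤j j≤H → p∤others 1≤j (m≤n⇒m≤1+n j≤H))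
    (p^k∣m*n⇒p^k∣n pp (p∤others (s≤s z≤n) ≤-refl (>⇒≢ (s≤s i≤H))) k
                   (subst (p ^ k ∣_) (*-comm (∏ N H f) _) p^k∣∏))
... | inj₂ refl =
  p^k∣m*n⇒p^k∣n pp (prime∤∏ N H pp (λ 1≤j j≤H → p∤others 1≤j (m≤n⇒m≤1+n j≤H) (<⇒≢ (s≤s j≤H)))) k p^k∣∏

intervalProduct≡∏ : ∀ N H → intervalProduct N H ≡ ∏ N H (λ x → x)
intervalProduct≡∏ N zero    = refl
intervalProduct≡∏ N (suc H) = cong (_* (N + suc H)) (intervalProduct≡∏ N H)

veryBad⇒p∣⇒p^2∣ : ∀ {N H p i} → VeryBad N H → Prime p → H < p → 1 ≤ i → i ≤ H → p ∣ N + i → p ^ 2 ∣ N + i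
veryBad⇒p∣⇒p^2∣ {N} {H} {p} {i} vb pp H<p 1≤i i≤H p∣N+i =
  p^k∣∏⇒p^k∣ N H {λ x → x} 2 pp 1≤i i≤H p∤others (subst (p ^ 2 ∣_) (intervalProduct≡∏ N H) (vb p pp p∣∏))
  where
  p∣∏ : p ∣ intervalProduct N H
  p∣∏ = ∣-trans p∣N+i (subst (N + i ∣_) (sym (intervalProduct≡∏ N H)) (∣∏ N H 1≤i i≤H))
  p∤others : ∀ {j} → 1 ≤ j → j ≤ H → j ≢ i → ¬ p ∣ N + j
  p∤others _ j≤H j≢i p∣N+j = j≢i (∣N+i∧∣N+j⇒i≡j H<p j≤H i≤H p∣N+j p∣N+i)

factorIf : {A : Set} → Dec A → ℕ → ℕ
factorIf (yes _) n = n
factorIf (no _)  n = 1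

factorIf-≥1 : ∀ {A : Set} (a : Dec A) {n} → 1 ≤ n → 1 ≤ factorIf a n
factorIf-≥1 (yes _) n≥1 = n≥1
factorIf-≥1 (no _)  _   = ≤-refl

factorIf-yes : ∀ {A : Set} (a : Dec A) {n} → A → factorIf a n ≡ n
factorIf-yes (yes _) _ = refl
factorIf-yes (no ¬a) a = contradiction a ¬a

factorIf-mono : ∀ {A B : Set} (a : Dec A) (b : Dec B) {n} → 1 ≤ n → (A → B) → factorIf a n ≤ factorIf b n
factorIf-mono (yes _) (yes _) _   _   = ≤-refl
factorIf-mono (yes a) (no ¬b) _   A⇒B = contradiction (A⇒B a) ¬b
factorIf-mono (no _)  b       n≥1 _   = factorIf-≥1 b n≥1

factorIf-cong : ∀ {A B : Set} (a : Dec A) (b : Dec B) {n} → (A → B) → (B → A) → factorIf a n ≡ factorIf b n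
factorIf-cong (yes _) (yes _) _   _   = refl
factorIf-cong (no _)  (no _)  _   _   = refl
factorIf-cong (yes a) (no ¬b) A⇒B _   = contradiction (A⇒B a) ¬b
factorIf-cong (no ¬a) (yes b) _   B⇒A = contradiction (B⇒A b) ¬a

prime∣factorIf⇒ : ∀ {A : Set} (a : Dec A) {n p} → Prime p → p ∣ factorIf a n → A × p ∣ n
prime∣factorIf⇒ (yes a) _  p∣n = a , p∣n
prime∣factorIf⇒ (no _)  pp p∣1 = contradiction p∣1 (prime∤1 pp)

primeIf : ℕ → ℕ
primeIf p = factorIf (prime? p) p

primeIf-≥1 : ∀ p → 1 ≤ primeIf p
primeIf-≥1 p with prime? p
... | yes pp = prime⇒≥1 pp
... | no _   = ≤-refl

primeIf-≤ : ∀ {p} → 1 ≤ p → primeIf p ≤ p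
primeIf-≤ {p} p≥1 with prime? p
... | yes _ = ≤-refl
... | no _  = p≥1

prime∣primeIf⇒≡ : ∀ {p q} → Prime p → p ∣ primeIf q → p ≡ q
prime∣primeIf⇒≡ {q = q} pp p∣ with prime∣factorIf⇒ (prime? q) pp p∣
... | pq , p∣q with prime⇒irreducible pq p∣q
...   | inj₁ refl = contradiction pp ¬prime[1]
...   | inj₂ p≡q  = p≡q

primeProduct : {P : ℕ → Set} → Decidable P → ℕ → ℕ
primeProduct P? K = ∏ 0 K (λ p → factorIf (P? p) (primeIf p))

primeProduct-≥1 : ∀ {P} (P? : Decidable P) K → 1 ≤ primeProduct P? K
primeProduct-≥1 P? K = ∏-≥1 0 K (λ p → factorIf-≥1 (P? p) (primeIf-≥1 p))

prime∣primeProduct⇒ : ∀ {P} (P? : Decidable P) K {p} → Prime p → p ∣ primeProduct P? K → p ≤ K × P p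
prime∣primeProduct⇒ P? zero    pp p∣1 = contradiction p∣1 (prime∤1 pp)
prime∣primeProduct⇒ P? (suc K) pp p∣∏ with euclidsLemma (primeProduct P? K) _ pp p∣∏
... | inj₁ p∣∏K with prime∣primeProduct⇒ P? K pp p∣∏K
...   | p≤K , Pp = m≤n⇒m≤1+n p≤K , Pp
prime∣primeProduct⇒ P? (suc K) pp p∣∏ | inj₂ p∣last with prime∣factorIf⇒ (P? (suc K)) pp p∣last
...   | P[1+K] , p∣primeIf with prime∣primeIf⇒≡ {q = suc K} pp p∣primeIf
...     | refl = ≤-refl , P[1+K]

prime∣primeProduct : ∀ {P} (P? : Decidable P) K {p} → Prime p → p ≤ K → P p → p ∣ primeProduct P? K
prime∣primeProduct P? K {p} pp p≤K Pp =
  subst (_∣ primeProduct P? K) (trans (factorIf-yes (P? p) Pp) (factorIf-yes (prime? p) pp))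
        (∣∏ 0 K (prime⇒≥1 pp) p≤K)

primeProduct∣ : ∀ {P} (P? : Decidable P) K {n} → (∀ {p} → Prime p → P p → p ∣ n) → primeProduct P? K ∣ n
primeProduct∣ P? zero    _   = 1∣ _
primeProduct∣ P? (suc K) {n} P⇒∣ with P? (suc K) | prime? (suc K)
... | yes P[1+K] | yes prime[1+K] =
  m∣n∧p∣n⇒m*p∣n prime[1+K] (λ 1+K∣∏ → n≮n K (proj₁ (prime∣primeProduct⇒ P? K prime[1+K] 1+K∣∏)))
                (primeProduct∣ P? K P⇒∣) (P⇒∣ prime[1+K] P[1+K])
... | yes _ | no _ = subst (_∣ n) (sym (*-identityʳ _)) (primeProduct∣ P? K P⇒∣)
... | no _  | _    = subst (_∣ n) (sym (*-identityʳ _)) (primeProduct∣ P? K P⇒∣)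

primeProduct-mono : ∀ {P Q} (P? : Decidable P) (Q? : Decidable Q) K → (∀ {p} → P p → Q p) →
                    primeProduct P? K ≤ primeProduct Q? K
primeProduct-mono P? Q? K P⇒Q = ∏-mono-≤ 0 K (λ {p} _ _ → factorIf-mono (P? p) (Q? p) (primeIf-≥1 p) P⇒Q)

_∥_ : ℕ → ℕ → Set
p ∥ n = p ∣ n × ¬ p ^ 2 ∣ n

_∥?_ : ∀ p n → Dec (p ∥ n)
p ∥? n = p ∣? n ×-dec ¬? (p ^ 2 ∣? n)

rad : ℕ → ℕ → ℕ
rad K n = primeProduct (_∣? n) K

exactRad : ℕ → ℕ → ℕ
exactRad K n = primeProduct (_∥? n) K

rad≤ : ∀ K {n} → 1 ≤ n → rad K n ≤ n
rad≤ K {n} n≥1 = ∣⇒≤ {{>-nonZero n≥1}} (primeProduct∣ (_∣? n) K (λ _ p∣n → p∣n))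

exactRad≤rad : ∀ K n → exactRad K n ≤ rad K n
exactRad≤rad K n = primeProduct-mono (_∥? n) (_∣? n) K proj₁

exactRad-cofactor-powerful : ∀ K {n q} → n ≡ q * exactRad K n →
                             (∀ {p} → Prime p → K < p → p ∣ n → p ^ 2 ∣ n) → Powerful q
exactRad-cofactor-powerful K {n} {q} n≡qA large⇒p^2∣ p pp p∣q =
  p^k∣m*n⇒p^k∣n pp p∤A 2 (subst (p ^ 2 ∣_) n≡Aq p^2∣n)
  where
  A = exactRad K n
  n≡Aq : n ≡ A * q
  n≡Aq = trans n≡qA (*-comm q A)
  p∣n : p ∣ n
  p∣n = ∣-trans p∣q (divides A n≡Aq)
  p∤A : ¬ p ∣ A
  p∤A p∣A = proj₂ (proj₂ (prime∣primeProduct⇒ (_∥? n) K pp p∣A))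
                  (subst₂ _∣_ (sym (p^2≡p*p p)) (sym n≡qA) (*-pres-∣ p∣q p∣A))
  p^2∣n : p ^ 2 ∣ n
  p^2∣n with p ≤? K | p ^ 2 ∣? n
  ... | _       | yes p^2∣n = p^2∣n
  ... | yes p≤K | no p^2∤n  = contradiction (prime∣primeProduct (_∥? n) K pp p≤K (p∣n , p^2∤n)) p∤A
  ... | no p≰K  | no _      = large⇒p^2∣ pp (≰⇒> p≰K) p∣n

veryBad⇒exactRad-cofactor : ∀ {N H i} → VeryBad N H → 1 ≤ i → i ≤ H →
                            ∃[ q ] (exactRad H (N + i) * q ≡ N + i × Powerful q)
veryBad⇒exactRad-cofactor {N} {H} {i} vb 1≤i i≤H with primeProduct∣ (_∥? (N + i)) H (λ _ → proj₁)
... | divides q N+i≡qA =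
  q , trans (*-comm _ q) (sym N+i≡qA) ,
  exactRad-cofactor-powerful H N+i≡qA (λ pp H<p → veryBad⇒p∣⇒p^2∣ vb pp H<p 1≤i i≤H)

-- An interval of length H contains at most one more multiple of m than (0, H].
∏-multiples≤ : ∀ m {c} → 1 ≤ c → ∀ N H →
               ∏ N H (λ x → factorIf (m ∣? x) c) ≤ c * ∏ 0 H (λ x → factorIf (m ∣? x) c)
∏-multiples≤ m {c} c≥1 N zero    = subst (1 ≤_) (sym (*-identityʳ c)) c≥1
∏-multiples≤ m {c} c≥1 N (suc H) = begin
    ∏ N (suc H) mark               ≡⟨ ∏-suc N H mark ⟩
    mark (suc N) * ∏ (suc N) H mark ≤⟨ first*rest≤ (m ∣? suc N) ⟩
    c * ∏ 0 H mark                 ≤⟨ *-monoʳ-≤ c (∏-≤-∏-suc 0 H (factorIf-≥1 (m ∣? suc H) c≥1)) ⟩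
    c * ∏ 0 (suc H) mark           ∎
  where
  open ≤-Reasoning
  mark : ℕ → ℕ
  mark x = factorIf (m ∣? x) c
  first*rest≤ : (d : Dec (m ∣ suc N)) → factorIf d c * ∏ (suc N) H mark ≤ c * ∏ 0 H mark
  first*rest≤ (yes m∣1+N) = ≤-reflexive (cong (c *_) (∏-cong (suc N) 0 H shift))
    where
    shift : ∀ i → mark (suc N + i) ≡ mark i
    shift i = factorIf-cong (m ∣? (suc N + i)) (m ∣? i) (λ m∣ → ∣m+n∣m⇒∣n m∣ m∣1+N) (∣m∣n⇒∣m+n m∣1+N)
  first*rest≤ (no _) = ≤-trans (≤-reflexive (*-identityˡ _)) (∏-multiples≤ m c≥1 (suc N) H)

∏-rad≤ : ∀ N H → ∏ N H (rad H) ≤ H ^ H * H ^ H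
∏-rad≤ N H = begin
    ∏ N H (rad H)
  ≡⟨ ∏-comm N H 0 H mark ⟩
    ∏ 0 H (λ p → ∏ N H (λ x → mark x p))
  ≤⟨ ∏-mono-≤ 0 H (λ {p} _ _ → ∏-multiples≤ p (primeIf-≥1 p) N H) ⟩
    ∏ 0 H (λ p → primeIf p * ∏ 0 H (λ x → mark x p))
  ≡⟨ ∏-distrib-* 0 H primeIf (λ p → ∏ 0 H (λ x → mark x p)) ⟩
    ∏ 0 H primeIf * ∏ 0 H (λ p → ∏ 0 H (λ x → mark x p))
  ≡⟨ cong (∏ 0 H primeIf *_) (∏-comm 0 H 0 H mark) ⟨
    ∏ 0 H primeIf * ∏ 0 H (rad H)
  ≤⟨ *-mono-≤ (∏-≤-^ 0 H H (λ 1≤p p≤H → ≤-trans (primeIf-≤ 1≤p) p≤H))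
              (∏-≤-^ 0 H H (λ 1≤x x≤H → ≤-trans (rad≤ H 1≤x) x≤H)) ⟩
    H ^ H * H ^ H
  ∎
  where
  open ≤-Reasoning
  mark : ℕ → ℕ → ℕ
  mark x p = factorIf (p ∣? x) (primeIf p)

∏<S^[1+H]⇒∏<S^H : ∀ N H {f : ℕ → ℕ} S → S ≤ f (N + suc H) → ∏ N (suc H) f < S ^ suc H → ∏ N H f < S ^ H
∏<S^[1+H]⇒∏<S^H N H {f} S S≤last ∏<S^1+H = *-cancelʳ-< S _ _ (begin-strict
    ∏ N H f * S   ≤⟨ *-monoʳ-≤ (∏ N H f) S≤last ⟩
    ∏ N (suc H) f <⟨ ∏<S^1+H ⟩
    S * S ^ H     ≡⟨ *-comm S (S ^ H) ⟩
    S ^ H * S     ∎)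
  where open ≤-Reasoning

∏*S<S^[1+H]⇒∏*X<S^H : ∀ N H {f : ℕ → ℕ} S {X} → X ≤ f (N + suc H) → ∏ N (suc H) f * S < S ^ suc H → ∏ N H f * X < S ^ H
∏*S<S^[1+H]⇒∏*X<S^H N H {f} S {X} X≤last ∏S<S^1+H = *-cancelʳ-< S _ _ (begin-strict
    ∏ N H f * X * S   ≤⟨ *-monoˡ-≤ S (*-monoʳ-≤ (∏ N H f) X≤last) ⟩
    ∏ N (suc H) f * S <⟨ ∏S<S^1+H ⟩
    S * S ^ H         ≡⟨ *-comm S (S ^ H) ⟩
    S ^ H * S         ∎)
  where open ≤-Reasoning

∃-small : ∀ N H {f : ℕ → ℕ} S → ∏ N H f < S ^ H → ∃[ i ] (1 ≤ i × i ≤ H × f (N + i) < S)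
∃-small N zero        S (s≤s ())
∃-small N (suc H) {f} S ∏<S^1+H with f (N + suc H) <? S
... | yes last<S = suc H , s≤s z≤n , ≤-refl , last<S
... | no last≮S with ∃-small N H S (∏<S^[1+H]⇒∏<S^H N H S (≮⇒≥ last≮S) ∏<S^1+H)
...   | i , 1≤i , i≤H , small = i , 1≤i , m≤n⇒m≤1+n i≤H , small

∃-two-small : ∀ N H {f : ℕ → ℕ} S .{{_ : NonZero S}} → (∀ x → 1 ≤ f x) → ∏ N H f * S < S ^ H →
              ∃[ i ] ∃[ j ] (1 ≤ i × i < j × j ≤ H × f (N + i) < S × f (N + j) < S)
∃-two-small N zero        S f≥1 S<1 = contradiction (subst (_< 1) (*-identityˡ S) S<1) (≤⇒≯ (>-nonZero⁻¹ S))
∃-two-small N (suc H) {f} S f≥1 ∏S<S^1+H with f (N + suc H) <? S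
... | yes last<S with ∃-small N H S (subst (_< S ^ H) (*-identityʳ _) (∏*S<S^[1+H]⇒∏*X<S^H N H S (f≥1 _) ∏S<S^1+H))
...   | i , 1≤i , i≤H , small-i = i , suc H , 1≤i , s≤s i≤H , ≤-refl , small-i , last<S
∃-two-small N (suc H) {f} S f≥1 ∏S<S^1+H | no last≮S
  with ∃-two-small N H S f≥1 (∏*S<S^[1+H]⇒∏*X<S^H N H S (≮⇒≥ last≮S) ∏S<S^1+H)
...   | i , j , 1≤i , i<j , j≤H , small-i , small-j = i , j , 1≤i , i<j , m≤n⇒m≤1+n j≤H , small-i , small-j

H^H*H^H*H^5<[H^5]^H : ∀ {H} → 1 < H → H ^ H * H ^ H * H ^ 5 < (H ^ 5) ^ H
H^H*H^H*H^5<[H^5]^H {H} 1<H = begin-strict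
    H ^ H * H ^ H * H ^ 5 ≡⟨ cong (_* H ^ 5) (^-distribˡ-+-* H H H) ⟨
    H ^ (H + H) * H ^ 5   ≡⟨ ^-distribˡ-+-* H (H + H) 5 ⟨
    H ^ (H + H + 5)       <⟨ ^-monoʳ-< H 1<H exponent< ⟩
    H ^ (5 * H)           ≡⟨ ^-*-assoc H 5 H ⟨
    (H ^ 5) ^ H           ∎
  where
  open ≤-Reasoning
  n+n+3n≡5n : ∀ n → n + n + 3 * n ≡ 5 * n
  n+n+3n≡5n = solve-∀
  exponent< : H + H + 5 < 5 * H
  exponent< = subst (H + H + 5 <_) (n+n+3n≡5n H) (+-monoʳ-< (H + H) (*-monoʳ-≤ 3 1<H))

lemma3p2 : ∃[ C ] (0 < C × (∀ N H → 1 < H → VeryBad N H →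
               ∃[ a ] ∃[ b ] ∃[ n ] ∃[ m ] ∃[ h ]
                 (a * n + h ≡ b * m)
                 × (N + 1 ≤ a * n × a * n ≤ N + H)
                 × (N + 1 ≤ b * m × b * m ≤ N + H)
                 × (1 ≤ h × h ≤ H)
                 × (a ≤ C * H ^ C × b ≤ C * H ^ C)
                 × (Powerful n × Powerful m)))
lemma3p2 = 5 , s≤s z≤n , λ N H 1<H vb →
  let S = H ^ 5
      (i , j , 1≤i , i<j , j≤H , small-i , small-j) =
        ∃-two-small N H S {{m^n≢0 H 5 {{>-nonZero (<-trans z<s 1<H)}}}} (λ x → primeProduct-≥1 (_∣? x) H)
          (≤-<-trans (*-monoˡ-≤ S (∏-rad≤ N H)) (H^H*H^H*H^5<[H^5]^H 1<H))
      i≤H = ≤-trans (<⇒≤ i<j) j≤H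
      1≤j = ≤-trans 1≤i (<⇒≤ i<j)
      (n , an≡N+i , n-powerful) = veryBad⇒exactRad-cofactor vb 1≤i i≤H
      (m , bm≡N+j , m-powerful) = veryBad⇒exactRad-cofactor vb 1≤j j≤H
      inInterval : ∀ {k x} → x ≡ N + k → 1 ≤ k → k ≤ H → N + 1 ≤ x × x ≤ N + H
      inInterval x≡N+k 1≤k k≤H =
        subst (λ x → N + 1 ≤ x × x ≤ N + H) (sym x≡N+k) (+-monoʳ-≤ N 1≤k , +-monoʳ-≤ N k≤H)
      bounded : ∀ {x} → rad H x < S → exactRad H x ≤ 5 * S
      bounded {x} small = ≤-trans (exactRad≤rad H x) (≤-trans (<⇒≤ small) (m≤n*m S 5))
  in exactRad H (N + i) , exactRad H (N + j) , n , m , j ∸ i ,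
     trans (cong (_+ (j ∸ i)) an≡N+i) (trans (m+n+[o∸n]≡m+o N (<⇒≤ i<j)) (sym bm≡N+j)) ,
     inInterval an≡N+i 1≤i i≤H , inInterval bm≡N+j 1≤j j≤H ,
     (m<n⇒0<n∸m i<j , ≤-trans (m∸n≤m j i) j≤H) ,
     (bounded small-i , bounded small-j) ,
     (n-powerful , m-powerful)
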